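{- Let $a_1,\ldots,a_n$ be nonnegative integers with $j$ entries equal to $0$, $k$ entries positive and even, and $l$ entries odd, $n=j+k+l$. If $j,k,l\ge1$ are all odd and $k+l\ge3$, then $RT(a_1,\ldots,a_n)$ is super edge-graceful.
   Context: For a finite simple graph $G$ with $p$ vertices and $q$ edges, $G$ is super edge-graceful if there is a bijection $f$ from $E(G)$ onto $\{0,\pm1,\ldots,\pm\frac{q-1}{2}\}$ when $q$ is odd, and onto $\{\pm1,\ldots,\pm\frac{q}{2}\}$ when $q$ is even, such that the induced vertex labeling $f^+(v)=\sum_{uv\in E(G)} f(uv)$ is a bijection from $V(G)$ onto $\{0,\pm1,\ldots,\pm\frac{p-1}{2}\}$ when $p$ is odd, and onto $\{\pm1,\ldots,\pm\frac{p}{2}\}$ when $p$ is even. For nonnegative integers $a_1,\ldots,a_n$, $RT(a_1,\ldots,a_n)$ is the rooted tree with root $v_0$, children $v_1,\ldots,v_n$ of $v_0$, where $v_i$ has exactly $a_i$ children, all of which are leaves. -}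

module Defs where

open import Data.Nat using (ℕ; zero; suc; _+_; _∸_; _≤_; _≟_; _≤?_; _/_)
open import Data.Nat.Divisibility using (_∣_; _∣?_)
open import Data.Integer as ℤ using (ℤ; ∣_∣) renaming (_+_ to _+ℤ_; 0ℤ to 0ℤ)
open import Data.Fin using (Fin; toℕ)
open import Data.List using (List; []; _∷_; _++_; length; lookup; filter; foldr; map; allFin)
open import Data.Nat.ListAction using (sum)
open import Data.Product using (_×_; _,_; proj₁; proj₂; Σ; ∃)
open import Data.Sum using (_⊎_)
open import Data.Bool using (Bool; if_then_else_; _∨_)
open import Relation.Nullary using (¬_; ¬?; does)
open import Relation.Nullary.Decidable using (_×-dec_)
open import Relation.Binary.PropositionalEquality using (_≡_; _≢_)
open import Function.Definitions using (Injective)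

-- A finite graph: vertices are 0,1,…,p-1 (indexed by Fin p);
-- edges are listed as pairs of vertex numbers, q = number of edges.
record Graph : Set where
  field
    p     : ℕ
    edges : List (ℕ × ℕ)

  q : ℕ
  q = length edges

open Graph public

LabelSet : ℕ → ℤ → Set
LabelSet m z =
  ((¬ (2 ∣ m)) × ∣ z ∣ ≤ (m ∸ 1) / 2)
  ⊎ ((2 ∣ m) × (z ≢ 0ℤ) × ∣ z ∣ ≤ m / 2)

BijOnto : {n : ℕ} → (Fin n → ℤ) → ℕ → Set
BijOnto {n} g m =
  Injective _≡_ _≡_ g
  × (∀ i → LabelSet m (g i))
  × (∀ z → LabelSet m z → ∃ λ i → g i ≡ z)

sumℤ : List ℤ → ℤ
sumℤ = foldr _+ℤ_ 0ℤ

incident : ℕ → ℕ × ℕ → Bool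
incident v (x , y) = does (v ≟ x) ∨ does (v ≟ y)

inducedLabel : (G : Graph) → (Fin (q G) → ℤ) → Fin (p G) → ℤ
inducedLabel G f v =
  sumℤ (map (λ e → if incident (toℕ v) (lookup (edges G) e) then f e else 0ℤ)
            (allFin (q G)))

SuperEdgeGraceful : Graph → Set
SuperEdgeGraceful G =
  Σ (Fin (q G) → ℤ) λ f → BijOnto f (q G) × BijOnto (inducedLabel G f) (p G)

-- The rooted tree RT(a₁,…,aₙ):
-- root = vertex 0, vᵢ = vertex i (1 ≤ i ≤ n), leaves numbered n+1, n+2, …
-- leafEdges i c as : edges from v_i, v_{i+1}, … to their leaf children,
-- the next fresh leaf number being c.
leafEdges : ℕ → ℕ → List ℕ → List (ℕ × ℕ)
leafEdges i c []       = []
leafEdges i c (a ∷ as) = star i c a ++ leafEdges (suc i) (c + a) as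
  where
  star : ℕ → ℕ → ℕ → List (ℕ × ℕ)
  star i c zero    = []
  star i c (suc a) = (i , c) ∷ star i (suc c) a

rootEdges : ℕ → ℕ → List (ℕ × ℕ)
rootEdges i zero    = []
rootEdges i (suc n) = (0 , i) ∷ rootEdges (suc i) n

RT : List ℕ → Graph
RT as = record
  { p     = 1 + length as + sum as
  ; edges = rootEdges 1 (length as) ++ leafEdges 1 (1 + length as) as
  }

countZero : List ℕ → ℕ
countZero as = length (filter (λ x → x ≟ 0) as)

countPosEven : List ℕ → ℕ
countPosEven as = length (filter (λ x → (1 ≤? x) ×-dec (2 ∣? x)) as)

countOdd : List ℕ → ℕ
countOdd as = length (filter (λ x → ¬? (2 ∣? x)) as)

-- A labelling of RT is described by its branches: for each vᵢ the label of the root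
-- edge v₀vᵢ and the labels of the edges to its leaves (Branch). As every leaf carries
-- the label of its edge, the branches give a super edge-graceful labelling as soon as
-- the edge labels are ±1, …, ±h and, up to order, the root sum and the labels of the
-- vᵢ are 0 and the root labels (IsSEL). They survive reordering the branches,
-- adding two childless branches labelled ±(h+1) and adding two leaves labelled ±(h+1)
-- to a branch, so every aᵢ may be replaced by its parity (admits-parity); and
-- RT(0, 0, 1, …, 1) with 2m+1 ones is labelled explicitly by nested pairs (Core).
-- Hence RT is super edge-graceful whenever j + k is even and positive and l is odd
-- (seg-by-parities).
module Submission where

open import Defs
open import Data.Nat as ℕ using (ℕ; zero; suc; _+_; _≤_; _<_; z≤n; s≤s)
open import Data.Nat.Properties as ℕP using ()
open import Data.Nat.DivMod using (m*n/n≡m)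
open import Data.Nat.Divisibility as Div using (_∣_; divides)
open import Data.Nat.ListAction using (sum)
open import Data.Integer using (ℤ; +_; -[1+_]; -_; ∣_∣; 0ℤ) renaming (_+_ to _+ℤ_)
open import Data.Integer.Properties as ℤP using ()
open import Data.Integer.Solver using (module +-*-Solver)
open import Data.Bool using (true; false; if_then_else_; _∨_)
open import Data.Bool.Properties as BoolP using ()
open import Data.Empty using (⊥-elim)
open import Data.Product using (_×_; _,_; proj₁; proj₂; Σ; ∃)
open import Data.Sum using (_⊎_; inj₁; inj₂)
open import Data.Fin as Fin using (Fin; toℕ; #_)
open import Data.Vec using ([]; _∷_)
open import Data.List as List using (List; []; _∷_; _++_; [_]; length; map; concatMap)
open import Data.List.Properties as ListP using ()
open import Data.List.Membership.Propositional using (_∈_)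
open import Data.List.Membership.Propositional.Properties using (∈-tabulate⁺; ∈-tabulate⁻)
open import Data.List.Relation.Unary.Any using (here; there)
open import Data.List.Relation.Unary.All as All using (All; []; _∷_)
open import Data.List.Relation.Unary.All.Properties as AllP using ()
open import Data.List.Relation.Unary.AllPairs using ([]; _∷_)
open import Data.List.Relation.Unary.Unique.Propositional using (Unique)
open import Data.List.Relation.Binary.Permutation.Propositional as Permutation
  using (_↭_; ↭-refl; ↭-sym; ↭-trans; ↭-prep; ↭-swap; ↭-reflexive; ↭⇒↭ₛ)
open import Data.List.Relation.Binary.Permutation.Propositional.Properties as Perm using ()
import Data.List.Relation.Binary.Permutation.Setoid.Properties as PermSetoid
open import Relation.Nullary using (¬_; ¬?; yes; no; does)
open import Relation.Nullary.Decidable using (dec-true; dec-false; _×-dec_)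
open import Relation.Binary.PropositionalEquality hiding ([_])
open import Algebra.Properties.CommutativeSemigroup ℕP.+-commutativeSemigroup
  using () renaming (interchange to +-interchange)
import Algebra.Solver.CommutativeMonoid as CommutativeMonoidSolver

-- Rearranging concatenations of lists up to permutation is the commutative-monoid
-- solver for (List ℤ, ++, []) modulo ↭.
open CommutativeMonoidSolver (Perm.++-commutativeMonoid {A = ℤ}) using (Expr; prove; var; _⊕_)

sumℤ-++ : ∀ xs ys → sumℤ (xs ++ ys) ≡ sumℤ xs +ℤ sumℤ ys
sumℤ-++ []       ys = sym (ℤP.+-identityˡ (sumℤ ys))
sumℤ-++ (x ∷ xs) ys = trans (cong (x +ℤ_) (sumℤ-++ xs ys)) (sym (ℤP.+-assoc x (sumℤ xs) (sumℤ ys)))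

sumℤ-↭ : ∀ {xs ys} → xs ↭ ys → sumℤ xs ≡ sumℤ ys
sumℤ-↭ p = PermSetoid.foldr-commMonoid (setoid ℤ) ℤP.+-0-isCommutativeMonoid (↭⇒↭ₛ p)

cancel : ∀ x s → x +ℤ (- x +ℤ s) ≡ s
cancel x s = trans (sym (ℤP.+-assoc x (- x) s)) (trans (cong (_+ℤ s) (ℤP.+-inverseʳ x)) (ℤP.+-identityˡ s))

signed : ℕ → List ℤ
signed zero    = []
signed (suc h) = + suc h ∷ -[1+ h ] ∷ signed h

∈-signed⁻ : ∀ h {z} → z ∈ signed h → z ≢ 0ℤ × ∣ z ∣ ≤ h
∈-signed⁻ (suc h) (here refl)         = (λ ()) , ℕP.≤-refl
∈-signed⁻ (suc h) (there (here refl)) = (λ ()) , ℕP.≤-refl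
∈-signed⁻ (suc h) (there (there z∈)) =
  let z≢0 , ∣z∣≤h = ∈-signed⁻ h z∈ in z≢0 , ℕP.m≤n⇒m≤1+n ∣z∣≤h

∈-signed⁺ : ∀ h {z} → z ≢ 0ℤ → ∣ z ∣ ≤ h → z ∈ signed h
∈-signed⁺ h {+ zero} z≢0 _ = ⊥-elim (z≢0 refl)
∈-signed⁺ (suc h) {+ suc n} _ ∣z∣≤ with n ℕ.≟ h
... | yes refl = here refl
... | no n≢h   = there (there (∈-signed⁺ h (λ ()) (ℕP.≤∧≢⇒< (ℕ.s≤s⁻¹ ∣z∣≤) n≢h)))
∈-signed⁺ (suc h) { -[1+ n ]} _ ∣z∣≤ with n ℕ.≟ h
... | yes refl = there (here refl)
... | no n≢h   = there (there (∈-signed⁺ h (λ ()) (ℕP.≤∧≢⇒< (ℕ.s≤s⁻¹ ∣z∣≤) n≢h)))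

-- signed h has no repetitions: the two new labels ±(h+1) have absolute value h+1.
signed-unique : ∀ h → Unique (signed h)
signed-unique zero    = []
signed-unique (suc h) = ((λ ()) ∷ fresh refl) ∷ fresh refl ∷ signed-unique h
  where
  fresh : ∀ {w} → ∣ w ∣ ≡ suc h → All (w ≢_) (signed h)
  fresh ∣w∣≡ = All.tabulate λ z∈ w≡z →
    ℕP.n≮n h (subst (_≤ h) ∣w∣≡ (subst (λ z → ∣ z ∣ ≤ h) (sym w≡z) (proj₂ (∈-signed⁻ h z∈))))

signed-nonzero : ∀ h → All (0ℤ ≢_) (signed h)
signed-nonzero h = All.tabulate λ z∈ 0≡z → proj₁ (∈-signed⁻ h z∈) (sym 0≡z)

sumℤ-signed : ∀ h → sumℤ (signed h) ≡ 0ℤ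
sumℤ-signed zero    = refl
sumℤ-signed (suc h) = trans (cancel (+ suc h) (sumℤ (signed h))) (sumℤ-signed h)

double : ∀ h → h + h ≡ h ℕ.* 2
double h = trans (cong (λ k → h + k) (sym (ℕP.+-identityʳ h))) (ℕP.*-comm 2 h)

half : ∀ h → (h + h) ℕ./ 2 ≡ h
half h = trans (cong (ℕ._/ 2) (double h)) (m*n/n≡m h 2)

even : ∀ h → 2 ∣ h + h
even h = divides h (double h)

odd : ∀ h → ¬ (2 ∣ suc (h + h))
odd h 2∣ with Div.∣1⇒≡1 (Div.∣m+n∣m⇒∣n (subst (2 ∣_) (ℕP.+-comm 1 (h + h)) 2∣) (even h))
... | ()

labelSet-even⁻ : ∀ h {z} → LabelSet (h + h) z → z ∈ signed h
labelSet-even⁻ h (inj₁ (2∤ , _))          = ⊥-elim (2∤ (even h))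
labelSet-even⁻ h (inj₂ (_ , z≢0 , ∣z∣≤)) = ∈-signed⁺ h z≢0 (subst (_ ≤_) (half h) ∣z∣≤)

labelSet-even⁺ : ∀ h {z} → z ∈ signed h → LabelSet (h + h) z
labelSet-even⁺ h z∈ = let z≢0 , ∣z∣≤ = ∈-signed⁻ h z∈ in
  inj₂ (even h , z≢0 , subst (_ ≤_) (sym (half h)) ∣z∣≤)

labelSet-odd⁻ : ∀ h {z} → LabelSet (suc (h + h)) z → z ∈ 0ℤ ∷ signed h
labelSet-odd⁻ h (inj₂ (2∣ , _))         = ⊥-elim (odd h 2∣)
labelSet-odd⁻ h {+ zero} (inj₁ _)       = here refl
labelSet-odd⁻ h {+ suc n} (inj₁ (_ , ∣z∣≤)) = there (∈-signed⁺ h (λ ()) (subst (_ ≤_) (half h) ∣z∣≤))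
labelSet-odd⁻ h { -[1+ n ]} (inj₁ (_ , ∣z∣≤)) = there (∈-signed⁺ h (λ ()) (subst (_ ≤_) (half h) ∣z∣≤))

labelSet-odd⁺ : ∀ h {z} → z ∈ 0ℤ ∷ signed h → LabelSet (suc (h + h)) z
labelSet-odd⁺ h (here refl) = inj₁ (odd h , z≤n)
labelSet-odd⁺ h (there z∈)  = inj₁ (odd h , subst (_ ≤_) (sym (half h)) (proj₂ (∈-signed⁻ h z∈)))

unique-↭ : ∀ {xs ys : List ℤ} → xs ↭ ys → Unique xs → Unique ys
unique-↭ p = PermSetoid.Unique-resp-↭ (setoid ℤ) (↭⇒↭ₛ p)

tabulate-injective : ∀ {N} (g : Fin N → ℤ) → Unique (List.tabulate g) → ∀ {i j} → g i ≡ g j → i ≡ j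
tabulate-injective g (_ ∷ u) {Fin.zero} {Fin.zero} _ = refl
tabulate-injective g (g0∉ ∷ _) {Fin.zero} {Fin.suc j} e = ⊥-elim (AllP.tabulate⁻ g0∉ j e)
tabulate-injective g (g0∉ ∷ _) {Fin.suc i} {Fin.zero} e = ⊥-elim (AllP.tabulate⁻ g0∉ i (sym e))
tabulate-injective g (_ ∷ u) {Fin.suc i} {Fin.suc j} e = cong Fin.suc (tabulate-injective (λ k → g (Fin.suc k)) u e)

bijOnto-↭ : ∀ {N} (g : Fin N → ℤ) m {cs : List ℤ} → List.tabulate g ↭ cs → Unique cs →
  (∀ {z} → z ∈ cs → LabelSet m z) → (∀ {z} → LabelSet m z → z ∈ cs) → BijOnto g m
bijOnto-↭ g m vals↭ u into onto =
  tabulate-injective g (unique-↭ (↭-sym vals↭) u) ,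
  (λ i → into (Perm.∈-resp-↭ vals↭ (∈-tabulate⁺ i))) ,
  λ z z∈ → let i , z≡ = ∈-tabulate⁻ (Perm.∈-resp-↭ (↭-sym vals↭) (onto z∈)) in i , sym z≡

-- Graphs given by lists of labelled edges

LEdge : Set
LEdge = (ℕ × ℕ) × ℤ

graphOf : ℕ → List LEdge → Graph
graphOf P ws = record { p = P ; edges = map proj₁ ws }

edgeLabel : (ws : List LEdge) → Fin (length (map proj₁ ws)) → ℤ
edgeLabel (w ∷ ws) Fin.zero    = proj₂ w
edgeLabel (w ∷ ws) (Fin.suc e) = edgeLabel ws e

edgeLabel-values : ∀ ws → List.tabulate (edgeLabel ws) ≡ map proj₂ ws
edgeLabel-values []       = refl
edgeLabel-values (w ∷ ws) = cong (proj₂ w ∷_) (edgeLabel-values ws)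

contribution : ℕ → LEdge → ℤ
contribution v w = if incident v (proj₁ w) then proj₂ w else 0ℤ

vlabel : ℕ → List LEdge → ℤ
vlabel v ws = sumℤ (map (contribution v) ws)

inducedLabel-vlabel : ∀ P ws (v : Fin P) →
  inducedLabel (graphOf P ws) (edgeLabel ws) v ≡ vlabel (toℕ v) ws
inducedLabel-vlabel P ws v = trans (cong sumℤ (ListP.map-tabulate (λ e → e) (at ws))) (go ws)
  where
  at : ∀ ws → Fin (length (map proj₁ ws)) → ℤ
  at ws e = if incident (toℕ v) (List.lookup (map proj₁ ws) e) then edgeLabel ws e else 0ℤ
  go : ∀ ws → sumℤ (List.tabulate (at ws)) ≡ vlabel (toℕ v) ws
  go []       = refl
  go (w ∷ ws) = cong (contribution (toℕ v) w +ℤ_) (go ws)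

range : ℕ → ℕ → List ℕ
range a zero    = []
range a (suc n) = a ∷ range (suc a) n

range-++ : ∀ a m n → range a (m + n) ≡ range a m ++ range (a + m) n
range-++ a zero n    = cong (λ b → range b n) (sym (ℕP.+-identityʳ a))
range-++ a (suc m) n =
  cong (a ∷_) (trans (range-++ (suc a) m n) (cong (λ b → range (suc a) m ++ range b n) (sym (ℕP.+-suc a m))))

map-range-suc : ∀ {A : Set} (f : ℕ → A) a n → map (λ v → f (suc v)) (range a n) ≡ map f (range (suc a) n)
map-range-suc f a zero    = refl
map-range-suc f a (suc n) = cong (f (suc a) ∷_) (map-range-suc f (suc a) n)

tabulate-range : ∀ {A : Set} (f : ℕ → A) n → List.tabulate (λ (i : Fin n) → f (toℕ i)) ≡ map f (range 0 n)
tabulate-range f zero    = refl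
tabulate-range f (suc n) = cong (f 0 ∷_) (trans (tabulate-range (λ v → f (suc v)) n) (map-range-suc f 0 n))

map-cong-range : ∀ {A : Set} {f g : ℕ → A} a n → (∀ v → a ≤ v → v < a + n → f v ≡ g v) →
  map f (range a n) ≡ map g (range a n)
map-cong-range a zero    f≗g = refl
map-cong-range a (suc n) f≗g =
  cong₂ _∷_ (f≗g a ℕP.≤-refl (ℕP.m<m+n a (s≤s z≤n)))
            (map-cong-range (suc a) n λ v a<v v< →
               f≗g v (ℕP.<⇒≤ a<v) (subst (v <_) (sym (ℕP.+-suc a n)) v<))

vlabel-++ : ∀ v xs ys → vlabel v (xs ++ ys) ≡ vlabel v xs +ℤ vlabel v ys
vlabel-++ v xs ys = trans (cong sumℤ (ListP.map-++ (contribution v) xs ys)) (sumℤ-++ (map (contribution v) xs) _)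

incident-left : ∀ v y → incident v (v , y) ≡ true
incident-left v y = cong (_∨ does (v ℕ.≟ y)) (dec-true (v ℕ.≟ v) refl)

incident-right : ∀ v x → incident v (x , v) ≡ true
incident-right v x = trans (cong (does (v ℕ.≟ x) ∨_) (dec-true (v ℕ.≟ v) refl)) (BoolP.∨-zeroʳ _)

incident-none : ∀ {v x y} → v ≢ x → v ≢ y → incident v (x , y) ≡ false
incident-none {v} {x} {y} v≢x v≢y = cong₂ _∨_ (dec-false (v ℕ.≟ x) v≢x) (dec-false (v ℕ.≟ y) v≢y)

Avoids : ℕ → List LEdge → Set
Avoids v ws = All (λ w → incident v (proj₁ w) ≡ false) ws

vlabel-avoids : ∀ v {ws} → Avoids v ws → vlabel v ws ≡ 0ℤ
vlabel-avoids v []            = refl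
vlabel-avoids v (v∉w ∷ v∉ws) rewrite v∉w = trans (ℤP.+-identityˡ _) (vlabel-avoids v v∉ws)

vlabel-avoidsˡ : ∀ v xs ys → Avoids v xs → vlabel v (xs ++ ys) ≡ vlabel v ys
vlabel-avoidsˡ v xs ys v∉xs =
  trans (vlabel-++ v xs ys) (trans (cong (_+ℤ vlabel v ys) (vlabel-avoids v v∉xs)) (ℤP.+-identityˡ _))

vlabel-avoidsʳ : ∀ v xs ys → Avoids v ys → vlabel v (xs ++ ys) ≡ vlabel v xs
vlabel-avoidsʳ v xs ys v∉ys =
  trans (vlabel-++ v xs ys) (trans (cong (vlabel v xs +ℤ_) (vlabel-avoids v v∉ys)) (ℤP.+-identityʳ _))

Outside : ℕ → ℕ → ℕ → Set
Outside v a n = v < a ⊎ a + n ≤ v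

outside-head : ∀ v a n → Outside v a (suc n) → v ≢ a
outside-head v a n (inj₁ v<a) refl = ℕP.n≮n v v<a
outside-head v a n (inj₂ ≤v)  refl = ℕP.m+1+n≰m v ≤v

outside-tail : ∀ v a n → Outside v a (suc n) → Outside v (suc a) n
outside-tail v a n (inj₁ v<a) = inj₁ (ℕP.m<n⇒m<1+n v<a)
outside-tail v a n (inj₂ ≤v)  = inj₂ (subst (_≤ v) (ℕP.+-suc a n) ≤v)

outside-split : ∀ v a m n → Outside v a (m + n) → Outside v a m × Outside v (a + m) n
outside-split v a m n (inj₁ v<a) = inj₁ v<a , inj₁ (ℕP.<-≤-trans v<a (ℕP.m≤m+n a m))
outside-split v a m n (inj₂ ≤v)  =
  inj₂ (ℕP.≤-trans (ℕP.m≤m+n (a + m) n) ≤v′) , inj₂ ≤v′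
  where
  ≤v′ : a + m + n ≤ v
  ≤v′ = subst (_≤ v) (sym (ℕP.+-assoc a m n)) ≤v

star : ℕ → ℕ → List ℤ → List LEdge
star ctr c []       = []
star ctr c (z ∷ zs) = ((ctr , c) , z) ∷ star ctr (suc c) zs

star-avoids : ∀ v ctr c zs → v ≢ ctr → Outside v c (length zs) → Avoids v (star ctr c zs)
star-avoids v ctr c []       _     _   = []
star-avoids v ctr c (z ∷ zs) v≢ctr out =
  incident-none v≢ctr (outside-head v c _ out) ∷ star-avoids v ctr (suc c) zs v≢ctr (outside-tail v c _ out)

star-centre : ∀ ctr c zs → vlabel ctr (star ctr c zs) ≡ sumℤ zs
star-centre ctr c []       = refl
star-centre ctr c (z ∷ zs) rewrite incident-left ctr c = cong (z +ℤ_) (star-centre ctr (suc c) zs)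

star-leaves : ∀ ctr c zs → ctr < c → map (λ v → vlabel v (star ctr c zs)) (range c (length zs)) ≡ zs
star-leaves ctr c []       _     = refl
star-leaves ctr c (z ∷ zs) ctr<c =
  cong₂ _∷_ leaf-c (trans later (star-leaves ctr (suc c) zs (ℕP.m<n⇒m<1+n ctr<c)))
  where
  leaf-c : vlabel c (star ctr c (z ∷ zs)) ≡ z
  leaf-c rewrite incident-right c ctr =
    trans (cong (z +ℤ_) (vlabel-avoids c (star-avoids c ctr (suc c) zs (ℕP.>⇒≢ ctr<c) (inj₁ ℕP.≤-refl))))
          (ℤP.+-identityʳ z)
  later : map (λ v → vlabel v (star ctr c (z ∷ zs))) (range (suc c) (length zs))
        ≡ map (λ v → vlabel v (star ctr (suc c) zs)) (range (suc c) (length zs))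
  later = map-cong-range (suc c) (length zs) λ v c<v _ →
    vlabel-avoidsˡ v [ (ctr , c) , z ] (star ctr (suc c) zs)
      (incident-none (ℕP.>⇒≢ (ℕP.<-trans ctr<c c<v)) (ℕP.>⇒≢ c<v) ∷ [])

-- Labelled rooted trees

-- A labelled branch vᵢ of RT: the label of the root edge v₀vᵢ together with the
-- labels of the edges from vᵢ to its leaves.
Branch : Set
Branch = ℤ × List ℤ

-- The sequence a₁, …, aₙ of a list of branches.
shape : List Branch → List ℕ
shape = map (λ b → length (proj₂ b))

rootLabels : List Branch → List ℤ
rootLabels = map proj₁

leafLabels : List Branch → List ℤ
leafLabels = concatMap proj₂

branchLabel : Branch → ℤ
branchLabel b = proj₁ b +ℤ sumℤ (proj₂ b)

-- The leaf edges of the branches D, the centres numbered i, i+1, … and the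
-- leaves c, c+1, … (RT numbers them exactly like this, with i = 1 and c = n+1).
leafStars : ℕ → ℕ → List Branch → List LEdge
leafStars i c []      = []
leafStars i c (b ∷ D) = star i c (proj₂ b) ++ leafStars (suc i) (c + length (proj₂ b)) D

leafStars-avoids : ∀ v i c D → Outside v i (length D) → Outside v c (sum (shape D)) → Avoids v (leafStars i c D)
leafStars-avoids v i c []      _     _     = []
leafStars-avoids v i c (b ∷ D) out-i out-c =
  let out-star , out-rest = outside-split v c (length (proj₂ b)) (sum (shape D)) out-c in
  AllP.++⁺ (star-avoids v i c (proj₂ b) (outside-head v i _ out-i) out-star)
           (leafStars-avoids v (suc i) _ D (outside-tail v i _ out-i) out-rest)

leafStars-centres : ∀ i c D → i + length D ≤ c →
  map (λ v → vlabel v (leafStars i c D)) (range i (length D)) ≡ map (λ b → sumℤ (proj₂ b)) D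
leafStars-centres i c []      _  = refl
leafStars-centres i c (b ∷ D) le = cong₂ _∷_ centre (trans later (leafStars-centres (suc i) c′ D le′))
  where
  c′ : ℕ
  c′ = c + length (proj₂ b)
  i<c : i < c
  i<c = ℕP.<-≤-trans (ℕP.m<m+n i (s≤s z≤n)) le
  le′ : suc i + length D ≤ c′
  le′ = ℕP.≤-trans (subst (_≤ c) (ℕP.+-suc i (length D)) le) (ℕP.m≤m+n c _)
  centre : vlabel i (leafStars i c (b ∷ D)) ≡ sumℤ (proj₂ b)
  centre = trans (vlabel-avoidsʳ i (star i c (proj₂ b)) _
                    (leafStars-avoids i (suc i) c′ D (inj₁ ℕP.≤-refl) (inj₁ (ℕP.<-≤-trans i<c (ℕP.m≤m+n c _)))))
                 (star-centre i c (proj₂ b))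
  later : map (λ v → vlabel v (leafStars i c (b ∷ D))) (range (suc i) (length D))
        ≡ map (λ v → vlabel v (leafStars (suc i) c′ D)) (range (suc i) (length D))
  later = map-cong-range (suc i) (length D) λ v i<v v< →
    vlabel-avoidsˡ v (star i c (proj₂ b)) _
      (star-avoids v i c (proj₂ b) (ℕP.>⇒≢ i<v) (inj₁ (ℕP.<-≤-trans v< (subst (_≤ c) (ℕP.+-suc i (length D)) le))))

leafStars-leaves : ∀ i c D → i + length D ≤ c →
  map (λ v → vlabel v (leafStars i c D)) (range c (sum (shape D))) ≡ leafLabels D
leafStars-leaves i c []      _  = refl
leafStars-leaves i c (b ∷ D) le =
  trans (cong (map (λ v → vlabel v (leafStars i c (b ∷ D)))) (range-++ c (length (proj₂ b)) (sum (shape D))))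
  (trans (ListP.map-++ _ (range c (length (proj₂ b))) _)
         (cong₂ _++_ (trans own (star-leaves i c (proj₂ b) i<c))
                     (trans later (leafStars-leaves (suc i) c′ D le′))))
  where
  c′ : ℕ
  c′ = c + length (proj₂ b)
  i+1+n≤c : suc i + length D ≤ c
  i+1+n≤c = subst (_≤ c) (ℕP.+-suc i (length D)) le
  i<c : i < c
  i<c = ℕP.<-≤-trans (ℕP.m<m+n i (s≤s z≤n)) le
  le′ : suc i + length D ≤ c′
  le′ = ℕP.≤-trans i+1+n≤c (ℕP.m≤m+n c _)
  own : map (λ v → vlabel v (leafStars i c (b ∷ D))) (range c (length (proj₂ b)))
      ≡ map (λ v → vlabel v (star i c (proj₂ b))) (range c (length (proj₂ b)))
  own = map-cong-range c _ λ v c≤v v<c′ →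
    vlabel-avoidsʳ v (star i c (proj₂ b)) _
      (leafStars-avoids v (suc i) c′ D (inj₂ (ℕP.≤-trans i+1+n≤c c≤v)) (inj₁ v<c′))
  later : map (λ v → vlabel v (leafStars i c (b ∷ D))) (range c′ (sum (shape D)))
        ≡ map (λ v → vlabel v (leafStars (suc i) c′ D)) (range c′ (sum (shape D)))
  later = map-cong-range c′ _ λ v c′≤v _ →
    vlabel-avoidsˡ v (star i c (proj₂ b)) _
      (star-avoids v i c (proj₂ b) (ℕP.>⇒≢ (ℕP.<-≤-trans i<c (ℕP.≤-trans (ℕP.m≤m+n c _) c′≤v)))
                   (inj₂ c′≤v))

treeEdges : List Branch → List LEdge
treeEdges D = star 0 1 (rootLabels D) ++ leafStars 1 (suc (length D)) D

order : List Branch → ℕ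
order D = suc (length D + sum (shape D))

star-labels : ∀ ctr c zs → map proj₂ (star ctr c zs) ≡ zs
star-labels ctr c []       = refl
star-labels ctr c (z ∷ zs) = cong (z ∷_) (star-labels ctr (suc c) zs)

leafStars-labels : ∀ i c D → map proj₂ (leafStars i c D) ≡ leafLabels D
leafStars-labels i c []      = refl
leafStars-labels i c (b ∷ D) =
  trans (ListP.map-++ proj₂ (star i c (proj₂ b)) _)
        (cong₂ _++_ (star-labels i c (proj₂ b)) (leafStars-labels (suc i) _ D))

treeEdges-labels : ∀ D → map proj₂ (treeEdges D) ≡ rootLabels D ++ leafLabels D
treeEdges-labels D =
  trans (ListP.map-++ proj₂ (star 0 1 (rootLabels D)) _)
        (cong₂ _++_ (star-labels 0 1 (rootLabels D)) (leafStars-labels 1 _ D))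

map-+ℤ : ∀ (f g : ℕ → ℤ) xs → map (λ v → f v +ℤ g v) xs ≡ List.zipWith _+ℤ_ (map f xs) (map g xs)
map-+ℤ f g []       = refl
map-+ℤ f g (x ∷ xs) = cong (f x +ℤ g x ∷_) (map-+ℤ f g xs)

zipWith-branchLabel : ∀ D → List.zipWith _+ℤ_ (rootLabels D) (map (λ b → sumℤ (proj₂ b)) D) ≡ map branchLabel D
zipWith-branchLabel []      = refl
zipWith-branchLabel (b ∷ D) = cong (branchLabel b ∷_) (zipWith-branchLabel D)

treeEdges-root : ∀ D → vlabel 0 (treeEdges D) ≡ sumℤ (rootLabels D)
treeEdges-root D =
  trans (vlabel-avoidsʳ 0 (star 0 1 (rootLabels D)) _
           (leafStars-avoids 0 1 (suc (length D)) D (inj₁ (s≤s z≤n)) (inj₁ (s≤s z≤n))))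
        (star-centre 0 1 (rootLabels D))

treeEdges-centres : ∀ D → map (λ v → vlabel v (treeEdges D)) (range 1 (length D)) ≡ map branchLabel D
treeEdges-centres D = begin
  map (λ v → vlabel v (treeEdges D)) (range 1 n)
    ≡⟨ ListP.map-cong (λ v → vlabel-++ v (star 0 1 rs) _) (range 1 n) ⟩
  map (λ v → vlabel v (star 0 1 rs) +ℤ vlabel v (leafStars 1 (suc n) D)) (range 1 n)
    ≡⟨ map-+ℤ _ _ (range 1 n) ⟩
  List.zipWith _+ℤ_ (map (λ v → vlabel v (star 0 1 rs)) (range 1 n))
                    (map (λ v → vlabel v (leafStars 1 (suc n) D)) (range 1 n))
    ≡⟨ cong₂ (List.zipWith _+ℤ_) rootStar-centres (leafStars-centres 1 (suc n) D ℕP.≤-refl) ⟩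
  List.zipWith _+ℤ_ rs (map (λ b → sumℤ (proj₂ b)) D)
    ≡⟨ zipWith-branchLabel D ⟩
  map branchLabel D ∎
  where
  open ≡-Reasoning
  n : ℕ
  n = length D
  rs : List ℤ
  rs = rootLabels D
  rootStar-centres : map (λ v → vlabel v (star 0 1 rs)) (range 1 n) ≡ rs
  rootStar-centres = subst (λ k → map (λ v → vlabel v (star 0 1 rs)) (range 1 k) ≡ rs)
                           (ListP.length-map proj₁ D) (star-leaves 0 1 rs (s≤s z≤n))

treeEdges-leaves : ∀ D →
  map (λ v → vlabel v (treeEdges D)) (range (suc (length D)) (sum (shape D))) ≡ leafLabels D
treeEdges-leaves D =
  trans (map-cong-range (suc (length D)) (sum (shape D)) λ v n<v _ →
           vlabel-avoidsˡ v (star 0 1 (rootLabels D)) _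
             (star-avoids v 0 1 (rootLabels D) (ℕP.>⇒≢ (ℕP.<-≤-trans (s≤s z≤n) n<v))
                (inj₂ (subst (λ k → suc k ≤ v) (sym (ListP.length-map proj₁ D)) n<v))))
        (leafStars-leaves 1 (suc (length D)) D ℕP.≤-refl)

treeEdges-vertexLabels : ∀ D →
  map (λ v → vlabel v (treeEdges D)) (range 0 (order D))
  ≡ (sumℤ (rootLabels D) ∷ map branchLabel D) ++ leafLabels D
treeEdges-vertexLabels D =
  cong₂ _∷_ (treeEdges-root D)
    (trans (cong (map label) (range-++ 1 (length D) (sum (shape D))))
    (trans (ListP.map-++ label (range 1 (length D)) _)
           (cong₂ _++_ (treeEdges-centres D) (treeEdges-leaves D))))
  where
  label : ℕ → ℤ
  label v = vlabel v (treeEdges D)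

rootStar-edges : ∀ c zs → map proj₁ (star 0 c zs) ≡ rootEdges c (length zs)
rootStar-edges c []       = refl
rootStar-edges c (z ∷ zs) = cong ((0 , c) ∷_) (rootStar-edges (suc c) zs)

star-edges : ∀ i c zs → map proj₁ (star i c zs) ≡ leafEdges i c (length zs ∷ [])
star-edges i c []       = refl
star-edges i c (z ∷ zs) = cong ((i , c) ∷_) (star-edges i (suc c) zs)

leafStars-edges : ∀ i c D → map proj₁ (leafStars i c D) ≡ leafEdges i c (shape D)
leafStars-edges i c []      = refl
leafStars-edges i c (b ∷ D) =
  trans (ListP.map-++ proj₁ (star i c (proj₂ b)) _)
        (cong₂ _++_ (trans (star-edges i c (proj₂ b)) (ListP.++-identityʳ _))
                    (leafStars-edges (suc i) _ D))

RT-treeEdges : ∀ D → RT (shape D) ≡ graphOf (order D) (treeEdges D)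
RT-treeEdges D = cong₂ (λ P es → record { p = P ; edges = es })
  (cong (λ k → suc (k + sum (shape D))) |shape|)
  (sym (trans (ListP.map-++ proj₁ (star 0 1 (rootLabels D)) _)
         (cong₂ _++_ (trans (rootStar-edges 1 (rootLabels D))
                            (cong (rootEdges 1) (trans (ListP.length-map proj₁ D) (sym |shape|))))
                     (trans (leafStars-edges 1 _ D)
                            (cong (λ k → leafEdges 1 (suc k) (shape D)) (sym |shape|))))))
  where
  |shape| : length (shape D) ≡ length D
  |shape| = ListP.length-map (λ b → length (proj₂ b)) D

-- D is a super edge-graceful labelling of RT(shape D) with edge labels ±1, …, ±h:
-- the edge labels are exactly signed h, and the vertex labels exactly 0 ∷ signed h.
-- Since every leaf label is both an edge and a vertex label, the second condition
-- only concerns the root and the branch vertices.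
IsSEL : ℕ → List Branch → Set
IsSEL h D = (rootLabels D ++ leafLabels D ↭ signed h)
          × (sumℤ (rootLabels D) ∷ map branchLabel D ↭ 0ℤ ∷ rootLabels D)

length-signed : ∀ h → length (signed h) ≡ h + h
length-signed zero    = refl
length-signed (suc h) = cong suc (trans (cong suc (length-signed h)) (sym (ℕP.+-suc h h)))

length-leafLabels : ∀ D → length (leafLabels D) ≡ sum (shape D)
length-leafLabels []      = refl
length-leafLabels (b ∷ D) = trans (ListP.length-++ (proj₂ b)) (cong (λ k → length (proj₂ b) + k) (length-leafLabels D))

edge-count : ∀ h D → rootLabels D ++ leafLabels D ↭ signed h → length (rootLabels D ++ leafLabels D) ≡ h + h
edge-count h D edges↭ = trans (Perm.↭-length edges↭) (length-signed h)

edgeBij : ∀ h D → rootLabels D ++ leafLabels D ↭ signed h →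
  BijOnto (edgeLabel (treeEdges D)) (length (map proj₁ (treeEdges D)))
edgeBij h D edges↭ = subst (BijOnto (edgeLabel ws)) (sym size)
  (bijOnto-↭ (edgeLabel ws) (h + h)
     (↭-trans (↭-reflexive (trans (edgeLabel-values ws) (treeEdges-labels D))) edges↭)
     (signed-unique h) (labelSet-even⁺ h) (labelSet-even⁻ h))
  where
  ws : List LEdge
  ws = treeEdges D
  size : length (map proj₁ ws) ≡ h + h
  size = trans (ListP.length-map proj₁ ws) (trans (sym (ListP.length-map proj₂ ws))
           (trans (cong length (treeEdges-labels D)) (edge-count h D edges↭)))

vertexBij : ∀ h D → IsSEL h D →
  BijOnto (inducedLabel (graphOf (order D) (treeEdges D)) (edgeLabel (treeEdges D))) (order D)
vertexBij h D (edges↭ , vertices↭) = subst (BijOnto _) (sym size)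
  (bijOnto-↭ _ (suc (h + h)) vertexLabels (signed-nonzero h ∷ signed-unique h) (labelSet-odd⁺ h) (labelSet-odd⁻ h))
  where
  ws : List LEdge
  ws = treeEdges D
  size : order D ≡ suc (h + h)
  size = cong suc (trans (cong₂ _+_ (sym (ListP.length-map proj₁ D)) (sym (length-leafLabels D)))
                         (trans (sym (ListP.length-++ (rootLabels D))) (edge-count h D edges↭)))
  vertexLabels : List.tabulate (inducedLabel (graphOf (order D) ws) (edgeLabel ws)) ↭ 0ℤ ∷ signed h
  vertexLabels = begin
    List.tabulate (inducedLabel (graphOf (order D) ws) (edgeLabel ws))
      ≡⟨ ListP.tabulate-cong (inducedLabel-vlabel (order D) ws) ⟩
    List.tabulate (λ i → vlabel (toℕ i) ws)
      ≡⟨ tabulate-range (λ v → vlabel v ws) (order D) ⟩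
    map (λ v → vlabel v ws) (range 0 (order D))
      ≡⟨ treeEdges-vertexLabels D ⟩
    (sumℤ (rootLabels D) ∷ map branchLabel D) ++ leafLabels D
      ↭⟨ Perm.++⁺ʳ (leafLabels D) vertices↭ ⟩
    0ℤ ∷ rootLabels D ++ leafLabels D
      ↭⟨ ↭-prep 0ℤ edges↭ ⟩
    0ℤ ∷ signed h ∎
    where open Permutation.PermutationReasoning

realise : ∀ h D → IsSEL h D → SuperEdgeGraceful (RT (shape D))
realise h D sel@(edges↭ , _) = subst SuperEdgeGraceful (sym (RT-treeEdges D))
  (edgeLabel (treeEdges D) , edgeBij h D edges↭ , vertexBij h D sel)

Admits : List ℕ → Set
Admits as = Σ ℕ λ h → Σ (List Branch) λ D → IsSEL h D × shape D ≡ as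

admits-seg : ∀ {as} → Admits as → SuperEdgeGraceful (RT as)
admits-seg (h , D , sel , refl) = realise h D sel

leafLabels-↭ : ∀ {D D′} → D ↭ D′ → leafLabels D ↭ leafLabels D′
leafLabels-↭ Permutation.refl           = ↭-refl
leafLabels-↭ (Permutation.prep b p)     = Perm.++⁺ˡ (proj₂ b) (leafLabels-↭ p)
leafLabels-↭ (Permutation.swap b b′ p)  =
  ↭-trans (Perm.shifts (proj₂ b) (proj₂ b′)) (Perm.++⁺ˡ (proj₂ b′) (Perm.++⁺ˡ (proj₂ b) (leafLabels-↭ p)))
leafLabels-↭ (Permutation.trans p q)    = ↭-trans (leafLabels-↭ p) (leafLabels-↭ q)

isSEL-↭ : ∀ {h D D′} → D ↭ D′ → IsSEL h D → IsSEL h D′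
isSEL-↭ {h} {D} {D′} p (edges↭ , vertices↭) =
  ↭-trans (Perm.++⁺ (Perm.map⁺ proj₁ (↭-sym p)) (leafLabels-↭ (↭-sym p))) edges↭ ,
  subst (λ s → s ∷ map branchLabel D′ ↭ 0ℤ ∷ rootLabels D′) (sumℤ-↭ (Perm.map⁺ proj₁ p))
    (↭-trans (↭-prep _ (Perm.map⁺ branchLabel (↭-sym p)))
             (↭-trans vertices↭ (↭-prep 0ℤ (Perm.map⁺ proj₁ p))))

admits-↭ : ∀ {as bs} → as ↭ bs → Admits as → Admits bs
admits-↭ p (h , D , sel , refl) with Perm.↭-map-inv (λ b → length (proj₂ b)) p
... | D′ , refl , q = h , D′ , isSEL-↭ q sel , refl

-- Two new childless vertices with root labels ±(h+1) keep the labelling valid: their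
-- labels cancel in the root sum and each vertex carries its own root label.
admits-zeros : ∀ {as} → Admits as → Admits (0 ∷ 0 ∷ as)
admits-zeros (h , D , (edges↭ , vertices↭) , refl) =
  suc h , (a , []) ∷ (- a , []) ∷ D , (↭-prep a (↭-prep (- a) edges↭) , vertices′↭) , refl
  where
  a : ℤ
  a = + suc h
  vertices′↭ : sumℤ (a ∷ - a ∷ rootLabels D) ∷ branchLabel (a , []) ∷ branchLabel (- a , []) ∷ map branchLabel D
             ↭ 0ℤ ∷ a ∷ - a ∷ rootLabels D
  vertices′↭ rewrite cancel a (sumℤ (rootLabels D)) | ℤP.+-identityʳ a | ℤP.+-identityʳ (- a) =
    ↭-trans (Perm.shifts [ sumℤ (rootLabels D) ] (a ∷ - a ∷ []))
    (↭-trans (Perm.++⁺ˡ (a ∷ - a ∷ []) vertices↭) (Perm.shifts (a ∷ - a ∷ []) [ 0ℤ ]))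

-- Two new leaves with labels ±(h+1) at the first branch cancel in its vertex label.
admits-grow : ∀ {b as} → Admits (b ∷ as) → Admits (suc (suc b) ∷ as)
admits-grow (h , (r , ls) ∷ D , (edges↭ , vertices↭) , refl) =
  suc h , (r , a ∷ - a ∷ ls) ∷ D , (edges′↭ , vertices′↭) , refl
  where
  a : ℤ
  a = + suc h
  edges′↭ : r ∷ rootLabels D ++ a ∷ - a ∷ ls ++ leafLabels D ↭ signed (suc h)
  edges′↭ = ↭-trans (Perm.shifts (r ∷ rootLabels D) (a ∷ - a ∷ [])) (↭-prep a (↭-prep (- a) edges↭))
  vertices′↭ : sumℤ (r ∷ rootLabels D) ∷ branchLabel (r , a ∷ - a ∷ ls) ∷ map branchLabel D
             ↭ 0ℤ ∷ r ∷ rootLabels D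
  vertices′↭ rewrite cancel a (sumℤ ls) = vertices↭

-- Reduction to entries 0 and 1

parity : ℕ → ℕ
parity zero          = 0
parity (suc zero)    = 1
parity (suc (suc n)) = parity n

admits-parity₁ : ∀ b {as} → Admits (parity b ∷ as) → Admits (b ∷ as)
admits-parity₁ zero          adm = adm
admits-parity₁ (suc zero)    adm = adm
admits-parity₁ (suc (suc b)) adm = admits-grow (admits-parity₁ b adm)

admits-parity : ∀ as ys → Admits (map parity as ++ ys) → Admits (as ++ ys)
admits-parity []       ys adm = adm
admits-parity (a ∷ as) ys adm =
  admits-↭ (Perm.shift a as ys)
    (admits-parity as (a ∷ ys) (admits-↭ (↭-sym (Perm.shift a (map parity as) ys)) (admits-parity₁ a adm)))

parity-even : ∀ n → 2 ∣ n → parity n ≡ 0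
parity-even zero          _  = refl
parity-even (suc zero)    2∣ with Div.∣1⇒≡1 2∣
... | ()
parity-even (suc (suc n)) 2∣ = parity-even n (Div.∣m+n∣m⇒∣n 2∣ Div.∣-refl)

parity-odd : ∀ n → ¬ (2 ∣ n) → parity n ≡ 1
parity-odd zero          2∤ = ⊥-elim (2∤ (2 Div.∣0))
parity-odd (suc zero)    _  = refl
parity-odd (suc (suc n)) 2∤ = parity-odd n (λ 2∣ → 2∤ (Div.∣m∣n⇒∣m+n Div.∣-refl 2∣))

parities-↭ : ∀ as → map parity as ↭ List.replicate (countZero as + countPosEven as) 0 ++ List.replicate (countOdd as) 1
parities-↭ [] = ↭-refl
parities-↭ (zero ∷ as)
  rewrite ListP.filter-accept (ℕ._≟ 0) {zero} {as} refl
        | ListP.filter-reject (λ x → (1 ℕ.≤? x) ×-dec (2 Div.∣? x)) {zero} {as} (λ { (() , _) })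
        | ListP.filter-reject (λ x → ¬? (2 Div.∣? x)) {zero} {as} (λ 2∤ → 2∤ (2 Div.∣0))
  = ↭-prep 0 (parities-↭ as)
parities-↭ (suc a ∷ as) with 2 Div.∣? suc a
... | yes 2∣
  rewrite ListP.filter-reject (ℕ._≟ 0) {suc a} {as} (λ ())
        | ListP.filter-accept (λ x → (1 ℕ.≤? x) ×-dec (2 Div.∣? x)) {suc a} {as} (s≤s z≤n , 2∣)
        | ListP.filter-reject (λ x → ¬? (2 Div.∣? x)) {suc a} {as} (λ 2∤ → 2∤ 2∣)
        | parity-even (suc a) 2∣
        | ℕP.+-suc (countZero as) (countPosEven as)
  = ↭-prep 0 (parities-↭ as)
... | no 2∤
  rewrite ListP.filter-reject (ℕ._≟ 0) {suc a} {as} (λ ())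
        | ListP.filter-reject (λ x → (1 ℕ.≤? x) ×-dec (2 Div.∣? x)) {suc a} {as} (λ (_ , 2∣) → 2∤ 2∣)
        | ListP.filter-accept (λ x → ¬? (2 Div.∣? x)) {suc a} {as} 2∤
        | parity-odd (suc a) 2∤
  = ↭-trans (↭-prep 1 (parities-↭ as))
            (↭-sym (Perm.shift 1 (List.replicate (countZero as + countPosEven as) 0) (List.replicate (countOdd as) 1)))

Balanced : List Branch → Set
Balanced D = (map branchLabel D ↭ rootLabels D) × (sumℤ (leafLabels D) ≡ 0ℤ)

leafLabels-++ : ∀ D E → leafLabels (D ++ E) ≡ leafLabels D ++ leafLabels E
leafLabels-++ D E = ListP.concatMap-++ proj₂ D E

balanced-++ : ∀ D E → Balanced D → Balanced E → Balanced (D ++ E)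
balanced-++ D E (vD , sD) (vE , sE) =
  ↭-trans (↭-reflexive (ListP.map-++ branchLabel D E))
    (↭-trans (Perm.++⁺ vD vE) (↭-reflexive (sym (ListP.map-++ proj₁ D E)))) ,
  trans (cong sumℤ (leafLabels-++ D E))
    (trans (sumℤ-++ (leafLabels D) (leafLabels E)) (cong₂ _+ℤ_ sD sE))

-- Childless branches: each vertex carries its own root label.
bare : List ℤ → List Branch
bare = map (λ z → z , [])

balanced-bare : ∀ zs → Balanced (bare zs)
balanced-bare []       = ↭-refl , refl
balanced-bare (z ∷ zs) = let v , s = balanced-bare zs in
  ↭-trans (↭-reflexive (cong (_∷ map branchLabel (bare zs)) (ℤP.+-identityʳ z))) (↭-prep z v) , s

-- The two one-leaf branches (x , [d]) and (x + d , [-d]): their vertex labels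
-- x + d and x are each other's root labels, and their leaf labels cancel.
block : ℤ → ℤ → List Branch
block x d = (x , [ d ]) ∷ (x +ℤ d , [ - d ]) ∷ []

balanced-block : ∀ x d → Balanced (block x d)
balanced-block x d =
  ↭-trans (↭-reflexive (cong₂ (λ u w → u ∷ w ∷ []) first second)) (↭-swap (x +ℤ d) x ↭-refl) ,
  cancel d 0ℤ
  where
  first : branchLabel (x , [ d ]) ≡ x +ℤ d
  first = cong (x +ℤ_) (ℤP.+-identityʳ d)
  second : branchLabel (x +ℤ d , [ - d ]) ≡ x
  second = begin
    (x +ℤ d) +ℤ (- d +ℤ 0ℤ) ≡⟨ cong ((x +ℤ d) +ℤ_) (ℤP.+-identityʳ (- d)) ⟩
    (x +ℤ d) +ℤ - d         ≡⟨ ℤP.+-assoc x d (- d) ⟩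
    x +ℤ (d +ℤ - d)         ≡⟨ cong (x +ℤ_) (ℤP.+-inverseʳ d) ⟩
    x +ℤ 0ℤ                 ≡⟨ ℤP.+-identityʳ x ⟩
    x                       ∎
    where open ≡-Reasoning

-- A branch with root label -a and a single leaf labelled a, followed by balanced
-- branches, is a labelling as soon as its edge labels are right: the edge labels sum
-- to 0, which forces the root sum to be -a, while the new branch vertex carries 0.
isSEL-balanced : ∀ h a E → Balanced E →
  rootLabels ((- a , [ a ]) ∷ E) ++ leafLabels ((- a , [ a ]) ∷ E) ↭ signed h →
  IsSEL h ((- a , [ a ]) ∷ E)
isSEL-balanced h a E (vE , sE) edges↭ = edges↭ , vertices↭
  where
  R : ℤ
  R = sumℤ (rootLabels E)
  total : (- a +ℤ R) +ℤ (a +ℤ 0ℤ) ≡ 0ℤ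
  total = begin
    (- a +ℤ R) +ℤ (a +ℤ 0ℤ)
      ≡⟨ cong (λ s → (- a +ℤ R) +ℤ (a +ℤ s)) (sym sE) ⟩
    sumℤ (- a ∷ rootLabels E) +ℤ sumℤ (a ∷ leafLabels E)
      ≡⟨ sym (sumℤ-++ (- a ∷ rootLabels E) (a ∷ leafLabels E)) ⟩
    sumℤ (- a ∷ rootLabels E ++ a ∷ leafLabels E)
      ≡⟨ sumℤ-↭ edges↭ ⟩
    sumℤ (signed h)
      ≡⟨ sumℤ-signed h ⟩
    0ℤ ∎
    where open ≡-Reasoning
  R≡0 : R ≡ 0ℤ
  R≡0 = trans (sym (solve 2 (λ a r → (:- a :+ r) :+ (a :+ con 0ℤ) := r) refl a R)) total
    where open +-*-Solver
  vertices↭ : sumℤ (- a ∷ rootLabels E) ∷ branchLabel (- a , [ a ]) ∷ map branchLabel E ↭ 0ℤ ∷ - a ∷ rootLabels E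
  vertices↭ rewrite R≡0 | ℤP.+-identityʳ (- a) | ℤP.+-identityʳ a | ℤP.+-inverseˡ a =
    ↭-trans (↭-prep (- a) (↭-prep 0ℤ vE)) (↭-swap (- a) 0ℤ ↭-refl)

-- Nested pairs

-- The nested pairs (x+1, x+len), (x+2, x+len-1), … in the interval x+1, …, x+len,
-- each recorded as its left end and its gap; for odd len the middle point is left over.
nest : ℕ → ℕ → List (ℕ × ℕ)
nest x zero          = []
nest x (suc zero)    = []
nest x (suc (suc l)) = (suc x , suc l) ∷ nest (suc x) l

middle : ℕ → ℕ → List ℕ
middle x zero          = []
middle x (suc zero)    = [ suc x ]
middle x (suc (suc l)) = middle (suc x) l

endpoints : List (ℕ × ℕ) → List ℕ
endpoints []             = []
endpoints ((y , δ) ∷ ps) = y ∷ y + δ ∷ endpoints ps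

gaps : List (ℕ × ℕ) → List ℕ
gaps = map proj₂

range-snoc : ∀ a n → range a (suc n) ≡ range a n ++ [ a + n ]
range-snoc a n = trans (cong (range a) (ℕP.+-comm 1 n)) (range-++ a n 1)

nest-endpoints : ∀ x len → endpoints (nest x len) ++ middle x len ↭ range (suc x) len
nest-endpoints x zero          = ↭-refl
nest-endpoints x (suc zero)    = ↭-refl
nest-endpoints x (suc (suc l)) = begin
  suc x ∷ suc x + suc l ∷ endpoints (nest (suc x) l) ++ middle (suc x) l
    ↭⟨ ↭-prep (suc x) (↭-prep (suc x + suc l) (nest-endpoints (suc x) l)) ⟩
  suc x ∷ suc x + suc l ∷ range (suc (suc x)) l
    ↭⟨ ↭-prep (suc x) (Perm.∷↭∷ʳ (suc x + suc l) (range (suc (suc x)) l)) ⟩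
  suc x ∷ range (suc (suc x)) l ++ [ suc x + suc l ]
    ≡⟨ cong (λ k → suc x ∷ range (suc (suc x)) l ++ [ k ]) (ℕP.+-suc (suc x) l) ⟩
  suc x ∷ range (suc (suc x)) l ++ [ suc (suc x) + l ]
    ≡⟨ cong (suc x ∷_) (sym (range-snoc (suc (suc x)) l)) ⟩
  range (suc x) (suc (suc l)) ∎
  where open Permutation.PermutationReasoning

nest-gaps : ∀ x y l → gaps (nest x (suc l)) ++ gaps (nest y l) ↭ range 1 l
nest-gaps x y zero    = ↭-refl
nest-gaps x y (suc l) = begin
  suc l ∷ gaps (nest (suc x) l) ++ gaps (nest y (suc l))
    ↭⟨ ↭-prep (suc l) (Perm.++-comm (gaps (nest (suc x) l)) _) ⟩
  suc l ∷ gaps (nest y (suc l)) ++ gaps (nest (suc x) l)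
    ↭⟨ ↭-prep (suc l) (nest-gaps y (suc x) l) ⟩
  suc l ∷ range 1 l
    ↭⟨ Perm.∷↭∷ʳ (suc l) (range 1 l) ⟩
  range 1 l ++ [ suc l ]
    ≡⟨ sym (range-snoc 1 l) ⟩
  range 1 (suc l) ∎
  where open Permutation.PermutationReasoning

middle-count : ∀ x y l → length (middle x (suc l)) + length (middle y l) ≡ 1
middle-count x y zero    = refl
middle-count x y (suc l) =
  trans (ℕP.+-comm (length (middle (suc x) l)) _) (middle-count y (suc x) l)

Pz Nz : List ℕ → List ℤ
Pz = map (λ n → + n)
Nz = map (λ n → - + n)

blocks : (ℕ → ℕ → ℤ) → List (ℕ × ℕ) → List Branch
blocks start []             = []
blocks start ((y , δ) ∷ ps) = block (start y δ) (+ δ) ++ blocks start ps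

balanced-blocks : ∀ start ps → Balanced (blocks start ps)
balanced-blocks start []             = ↭-refl , refl
balanced-blocks start ((y , δ) ∷ ps) =
  balanced-++ (block (start y δ) (+ δ)) _ (balanced-block (start y δ) (+ δ)) (balanced-blocks start ps)

blocks-leafLabels : ∀ start ps → leafLabels (blocks start ps) ↭ Pz (gaps ps) ++ Nz (gaps ps)
blocks-leafLabels start []             = ↭-refl
blocks-leafLabels start ((y , δ) ∷ ps) =
  ↭-prep (+ δ) (↭-trans (↭-prep (- + δ) (blocks-leafLabels start ps))
                        (↭-sym (Perm.shift (- + δ) (Pz (gaps ps)) (Nz (gaps ps)))))

blocks-shape : ∀ start ps → shape (blocks start ps) ≡ List.replicate (length ps + length ps) 1
blocks-shape start []             = refl
blocks-shape start ((y , δ) ∷ ps) =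
  cong (1 ∷_) (trans (cong (1 ∷_) (blocks-shape start ps))
                     (cong (λ k → List.replicate k 1) (sym (ℕP.+-suc (length ps) (length ps)))))

posBlocks : List (ℕ × ℕ) → List Branch
posBlocks = blocks (λ y δ → + y)

posBlocks-rootLabels : ∀ ps → rootLabels (posBlocks ps) ≡ Pz (endpoints ps)
posBlocks-rootLabels []             = refl
posBlocks-rootLabels ((y , δ) ∷ ps) = cong (λ rs → + y ∷ + (y + δ) ∷ rs) (posBlocks-rootLabels ps)

negBlocks : List (ℕ × ℕ) → List Branch
negBlocks = blocks (λ y δ → - + (y + δ))

negBlocks-rootLabels : ∀ ps → rootLabels (negBlocks ps) ↭ Nz (endpoints ps)
negBlocks-rootLabels []             = ↭-refl
negBlocks-rootLabels ((y , δ) ∷ ps) =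
  ↭-trans (↭-reflexive (cong (λ z → - + (y + δ) ∷ z ∷ rootLabels (negBlocks ps)) right-end))
          (↭-swap (- + (y + δ)) (- + y) (negBlocks-rootLabels ps))
  where
  right-end : - + (y + δ) +ℤ + δ ≡ - + y
  right-end = begin
    - (+ y +ℤ + δ) +ℤ + δ      ≡⟨ cong (_+ℤ + δ) (ℤP.neg-distrib-+ (+ y) (+ δ)) ⟩
    (- + y +ℤ - + δ) +ℤ + δ    ≡⟨ ℤP.+-assoc (- + y) (- + δ) (+ δ) ⟩
    - + y +ℤ (- + δ +ℤ + δ)    ≡⟨ cong (- + y +ℤ_) (ℤP.+-inverseˡ (+ δ)) ⟩
    - + y +ℤ 0ℤ                ≡⟨ ℤP.+-identityʳ (- + y) ⟩
    - + y                      ∎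
    where open ≡-Reasoning

bare-rootLabels : ∀ zs → rootLabels (bare zs) ≡ zs
bare-rootLabels []       = refl
bare-rootLabels (z ∷ zs) = cong (z ∷_) (bare-rootLabels zs)

bare-leafLabels : ∀ zs → leafLabels (bare zs) ≡ []
bare-leafLabels []       = refl
bare-leafLabels (z ∷ zs) = bare-leafLabels zs

bare-shape : ∀ zs → shape (bare zs) ≡ List.replicate (length zs) 0
bare-shape []       = refl
bare-shape (z ∷ zs) = cong (0 ∷_) (bare-shape zs)

signed-ranges : ∀ h → Pz (range 1 h) ++ Nz (range 1 h) ↭ signed h
signed-ranges zero    = ↭-refl
signed-ranges (suc h) = begin
  Pz (range 1 (suc h)) ++ Nz (range 1 (suc h))
    ≡⟨ cong (λ xs → Pz xs ++ Nz xs) (range-snoc 1 h) ⟩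
  Pz (range 1 h ++ [ suc h ]) ++ Nz (range 1 h ++ [ suc h ])
    ≡⟨ cong₂ _++_ (ListP.map-++ _ (range 1 h) [ suc h ]) (ListP.map-++ _ (range 1 h) [ suc h ]) ⟩
  (Pz (range 1 h) ++ [ + suc h ]) ++ (Nz (range 1 h) ++ [ -[1+ h ] ])
    ↭⟨ prove 4 ((pos ⊕ a) ⊕ (neg ⊕ b)) (a ⊕ b ⊕ (pos ⊕ neg))
             (Pz (range 1 h) ∷ [ + suc h ] ∷ Nz (range 1 h) ∷ [ -[1+ h ] ] ∷ []) ⟩
  + suc h ∷ -[1+ h ] ∷ Pz (range 1 h) ++ Nz (range 1 h)
    ↭⟨ ↭-prep _ (↭-prep _ (signed-ranges h)) ⟩
  signed (suc h) ∎
  where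
  open Permutation.PermutationReasoning
  pos a neg b : Expr 4
  pos = var (# 0); a = var (# 1); neg = var (# 2); b = var (# 3)

length-range : ∀ a n → length (range a n) ≡ n
length-range a zero    = refl
length-range a (suc n) = cong suc (length-range (suc a) n)

replicate-++ : ∀ {A : Set} m n (x : A) → List.replicate m x ++ List.replicate n x ≡ List.replicate (m + n) x
replicate-++ zero    n x = refl
replicate-++ (suc m) n x = cong (x ∷_) (replicate-++ m n x)

map-↭-parts : ∀ (f : ℕ → ℤ) g₁ g₂ e₁ e₂ rest {G E} → g₁ ++ g₂ ↭ G → e₁ ++ e₂ ↭ E →
  (map f g₁ ++ map f g₂) ++ (map f e₁ ++ map f e₂) ++ map f rest ↭ map f (G ++ E ++ rest)
map-↭-parts f g₁ g₂ e₁ e₂ rest {G} {E} g↭ e↭ =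
  ↭-trans (Perm.++⁺ (merge g₁ g₂ g↭) (Perm.++⁺ʳ (map f rest) (merge e₁ e₂ e↭)))
          (↭-reflexive (sym (trans (ListP.map-++ f G (E ++ rest)) (cong (map f G ++_) (ListP.map-++ f E rest)))))
  where
  merge : ∀ xs ys {zs} → xs ++ ys ↭ zs → map f xs ++ map f ys ↭ map f zs
  merge xs ys p = ↭-trans (↭-reflexive (sym (ListP.map-++ f xs ys))) (Perm.map⁺ f p)

-- The branch (-h , [h]) carries 0; the positive blocks on the nested pairs of
-- m+1, …, 2m+1 and the negative blocks on those of m+1, …, 2m use every gap 1, …, m
-- once (nest-gaps); the two left-over root labels are -(2m+1) and the middle point
-- of the one interval of odd length.
module Core (m : ℕ) where
  h top : ℕ
  h   = suc (suc (m + m))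
  top = suc (m + m)

  A B : List (ℕ × ℕ)
  A = nest m (suc m)
  B = nest m m

  leftovers : List ℤ
  leftovers = Pz (middle m (suc m)) ++ Nz (middle m m) ++ [ - + top ]

  E : List Branch
  E = posBlocks A ++ negBlocks B ++ bare leftovers

  D : List Branch
  D = (- + h , [ + h ]) ∷ E

  range-split : range 1 h ≡ range 1 m ++ range (suc m) (suc (suc m))
  range-split = trans (cong (range 1) (sym (trans (ℕP.+-suc m (suc m)) (cong suc (ℕP.+-suc m m)))))
                      (range-++ 1 m (suc (suc m)))

  range-pos : range 1 h ≡ range 1 m ++ range (suc m) (suc m) ++ [ h ]
  range-pos = trans range-split
    (cong (range 1 m ++_) (trans (range-snoc (suc m) (suc m)) (cong (λ k → range (suc m) (suc m) ++ [ suc k ]) (ℕP.+-suc m m))))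

  range-neg : range 1 h ≡ range 1 m ++ range (suc m) m ++ top ∷ h ∷ []
  range-neg = trans range-split (cong (range 1 m ++_) (trans (cong (range (suc m)) (ℕP.+-comm 2 m)) (range-++ (suc m) m 2)))

  rootLabels-E : rootLabels E ↭ Pz (endpoints A) ++ Nz (endpoints B) ++ leftovers
  rootLabels-E =
    ↭-trans (↭-reflexive (trans (ListP.map-++ proj₁ (posBlocks A) _)
                                (cong (rootLabels (posBlocks A) ++_) (ListP.map-++ proj₁ (negBlocks B) _))))
            (Perm.++⁺ (↭-reflexive (posBlocks-rootLabels A))
                      (Perm.++⁺ (negBlocks-rootLabels B) (↭-reflexive (bare-rootLabels leftovers))))

  leafLabels-E : leafLabels E ↭ (Pz (gaps A) ++ Nz (gaps A)) ++ (Pz (gaps B) ++ Nz (gaps B))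
  leafLabels-E =
    ↭-trans (↭-reflexive (trans (leafLabels-++ (posBlocks A) _)
                                (cong (leafLabels (posBlocks A) ++_)
                                      (trans (leafLabels-++ (negBlocks B) _)
                                             (trans (cong (leafLabels (negBlocks B) ++_) (bare-leafLabels leftovers))
                                                    (ListP.++-identityʳ _))))))
            (Perm.++⁺ (blocks-leafLabels _ A) (blocks-leafLabels _ B))

  -- Regrouped by sign, the labels are the intervals split up by range-pos and range-neg.
  edgeLabels : rootLabels D ++ leafLabels D ↭ signed h
  edgeLabels = begin
    - + h ∷ rootLabels E ++ + h ∷ leafLabels E
      ↭⟨ ↭-prep (- + h) (Perm.++⁺ rootLabels-E (↭-prep (+ h) leafLabels-E)) ⟩
    - + h ∷ (Pz eA ++ Nz eB ++ Pz mA ++ Nz mB ++ [ - + top ]) ++ + h ∷ (Pz gA ++ Nz gA) ++ (Pz gB ++ Nz gB)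
      ↭⟨ prove 11 (mh ⊕ ((eAp ⊕ (eBn ⊕ (mAp ⊕ (mBn ⊕ topn)))) ⊕ (ph ⊕ ((gAp ⊕ gAn) ⊕ (gBp ⊕ gBn)))))
                  (((gAp ⊕ gBp) ⊕ ((eAp ⊕ mAp) ⊕ ph)) ⊕ ((gAn ⊕ gBn) ⊕ ((eBn ⊕ mBn) ⊕ (topn ⊕ mh))))
                  ([ - + h ] ∷ [ + h ] ∷ Pz eA ∷ Nz eB ∷ Pz mA ∷ Nz mB ∷ [ - + top ] ∷
                   Pz gA ∷ Nz gA ∷ Pz gB ∷ Nz gB ∷ []) ⟩
    ((Pz gA ++ Pz gB) ++ (Pz eA ++ Pz mA) ++ Pz [ h ]) ++ ((Nz gA ++ Nz gB) ++ (Nz eB ++ Nz mB) ++ Nz (top ∷ h ∷ []))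
      ↭⟨ Perm.++⁺ (map-↭-parts (λ n → + n) gA gB eA mA [ h ] (nest-gaps m m m) (nest-endpoints m (suc m)))
                  (map-↭-parts (λ n → - + n) gA gB eB mB (top ∷ h ∷ []) (nest-gaps m m m) (nest-endpoints m m)) ⟩
    Pz (range 1 m ++ range (suc m) (suc m) ++ [ h ]) ++ Nz (range 1 m ++ range (suc m) m ++ top ∷ h ∷ [])
      ≡⟨ sym (cong₂ (λ xs ys → Pz xs ++ Nz ys) range-pos range-neg) ⟩
    Pz (range 1 h) ++ Nz (range 1 h)
      ↭⟨ signed-ranges h ⟩
    signed h ∎
    where
    open Permutation.PermutationReasoning
    eA eB gA gB mA mB : List ℕ
    eA = endpoints A; eB = endpoints B; gA = gaps A; gB = gaps B
    mA = middle m (suc m); mB = middle m m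
    mh ph eAp eBn mAp mBn topn gAp gAn gBp gBn : Expr 11
    mh = var (# 0); ph = var (# 1); eAp = var (# 2); eBn = var (# 3); mAp = var (# 4); mBn = var (# 5)
    topn = var (# 6); gAp = var (# 7); gAn = var (# 8); gBp = var (# 9); gBn = var (# 10)

  isSEL : IsSEL h D
  isSEL = isSEL-balanced h (+ h) E
    (balanced-++ (posBlocks A) _ (balanced-blocks _ A)
      (balanced-++ (negBlocks B) _ (balanced-blocks _ B) (balanced-bare leftovers)))
    edgeLabels

  pairs : length A + length B ≡ m
  pairs = begin
    length A + length B               ≡⟨ sym (cong₂ _+_ (ListP.length-map proj₂ A) (ListP.length-map proj₂ B)) ⟩
    length (gaps A) + length (gaps B) ≡⟨ sym (ListP.length-++ (gaps A)) ⟩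
    length (gaps A ++ gaps B)         ≡⟨ Perm.↭-length (nest-gaps m m m) ⟩
    length (range 1 m)                ≡⟨ length-range 1 m ⟩
    m                                 ∎
    where open ≡-Reasoning

  two-leftovers : length leftovers ≡ 2
  two-leftovers = begin
    length leftovers
      ≡⟨ ListP.length-++ (Pz (middle m (suc m))) ⟩
    length (Pz (middle m (suc m))) + length (Nz (middle m m) ++ [ - + top ])
      ≡⟨ cong₂ _+_ (ListP.length-map _ (middle m (suc m)))
                   (trans (ListP.length-++ (Nz (middle m m))) (cong (_+ 1) (ListP.length-map _ (middle m m)))) ⟩
    length (middle m (suc m)) + (length (middle m m) + 1)
      ≡⟨ sym (ℕP.+-assoc (length (middle m (suc m))) _ 1) ⟩
    length (middle m (suc m)) + length (middle m m) + 1
      ≡⟨ cong (_+ 1) (middle-count m m m) ⟩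
    2 ∎
    where open ≡-Reasoning

  shape-D : shape D ↭ 0 ∷ 0 ∷ List.replicate (suc (m + m)) 1
  shape-D = begin
    1 ∷ shape E
      ≡⟨ cong (1 ∷_) (trans (ListP.map-++ _ (posBlocks A) _)
                            (cong (shape (posBlocks A) ++_) (ListP.map-++ _ (negBlocks B) _))) ⟩
    1 ∷ shape (posBlocks A) ++ shape (negBlocks B) ++ shape (bare leftovers)
      ≡⟨ cong (1 ∷_) (trans (sym (ListP.++-assoc (shape (posBlocks A)) _ _))
                            (cong₂ _++_ ones (trans (bare-shape leftovers)
                                                    (cong (λ k → List.replicate k 0) two-leftovers)))) ⟩
    1 ∷ List.replicate (m + m) 1 ++ 0 ∷ 0 ∷ []
      ↭⟨ Perm.++-comm (1 ∷ List.replicate (m + m) 1) (0 ∷ 0 ∷ []) ⟩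
    0 ∷ 0 ∷ List.replicate (suc (m + m)) 1 ∎
    where
    open Permutation.PermutationReasoning
    ones : shape (posBlocks A) ++ shape (negBlocks B) ≡ List.replicate (m + m) 1
    ones = trans (cong₂ _++_ (blocks-shape _ A) (blocks-shape _ B))
          (trans (replicate-++ (length A + length A) _ 1)
          (cong (λ k → List.replicate k 1)
                (trans (+-interchange (length A) (length A) (length B) (length B)) (cong₂ _+_ pairs pairs))))

admits-core : ∀ m → Admits (0 ∷ 0 ∷ List.replicate (suc (m + m)) 1)
admits-core m = admits-↭ shape-D (h , D , isSEL , refl)
  where open Core m

admits-zeros-ones : ∀ t c → Admits (List.replicate (suc (suc (t + t))) 0 ++ List.replicate (suc (c + c)) 1)
admits-zeros-ones zero    c = admits-core c
admits-zeros-ones (suc t) c =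
  subst (λ k → Admits (List.replicate (suc (suc k)) 0 ++ List.replicate (suc (c + c)) 1))
        (sym (ℕP.+-suc (suc t) t)) (admits-zeros (admits-zeros-ones t c))

seg-by-parities : ∀ as t c →
  countZero as + countPosEven as ≡ suc (suc (t + t)) → countOdd as ≡ suc (c + c) →
  SuperEdgeGraceful (RT as)
seg-by-parities as t c evens odds = admits-seg (subst Admits (ListP.++-identityʳ as) (admits-parity as [] parities))
  where
  parities : Admits (map parity as ++ [])
  parities = subst Admits (sym (ListP.++-identityʳ (map parity as)))
    (admits-↭ (↭-sym (parities-↭ as))
      (subst₂ (λ z o → Admits (List.replicate z 0 ++ List.replicate o 1)) (sym evens) (sym odds)
              (admits-zeros-ones t c)))

odd-form : ∀ n → ¬ (2 ∣ n) → ∃ λ c → n ≡ suc (c + c)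
odd-form zero          2∤ = ⊥-elim (2∤ (2 Div.∣0))
odd-form (suc zero)    _  = 0 , refl
odd-form (suc (suc n)) 2∤ with odd-form n (λ 2∣ → 2∤ (Div.∣m∣n⇒∣m+n Div.∣-refl 2∣))
... | c , refl = suc c , cong (λ k → suc (suc k)) (sym (ℕP.+-suc c c))

sum-of-odds : ∀ a b → suc (a + a) + suc (b + b) ≡ suc (suc ((a + b) + (a + b)))
sum-of-odds a b = cong suc (trans (ℕP.+-suc (a + a) (b + b)) (cong suc (+-interchange a a b b)))

lemma8 : (as : List ℕ) →
    1 ≤ countZero as → 1 ≤ countPosEven as → 1 ≤ countOdd as →
    ¬ (2 ∣ countZero as) → ¬ (2 ∣ countPosEven as) → ¬ (2 ∣ countOdd as) →
    3 ≤ countPosEven as + countOdd as →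
    SuperEdgeGraceful (RT as)
lemma8 as _ _ _ 2∤j 2∤k 2∤l _
  with odd-form (countZero as) 2∤j | odd-form (countPosEven as) 2∤k | odd-form (countOdd as) 2∤l
... | a , j≡ | b , k≡ | c , l≡ = seg-by-parities as (a + b) c (trans (cong₂ _+_ j≡ k≡) (sum-of-odds a b)) l≡
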